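{- Let $G=(V,E)$ be a graph with $n=|V|$ and $k\ge 0$. Suppose that $h_2(\pi)>k$ for every extreme 2-partition $\pi$ of $V$. If there exists a non-trivial and non-extreme 2-partition $\pi$ of $V$ with $h_2(\pi)\le k$, then there exist a vertex $s\in V$ and a $(K,t)$-feasible flipping set $F$ for $\pi_0=(N_G[s],V\setminus N_G[s])$ with $|F|\le f$, where $K=\sqrt{nk}$, $t=\sqrt{n(n-1)/2}$ and $f=\sqrt{k/n}$.
   Context: $N_G[s]$ is the closed neighborhood $\{u:(u,s)\in E\}\cup\{s\}$. A 2-partition of $V$ is an unordered pair $\pi=(V_1,V_2)$ with $V_1\cap V_2=\emptyset$, $V_1\cup V_2=V$; it is trivial if $V_1$ or $V_2$ is empty, and extreme if $|V_1|=1$ or $|V_2|=1$. Two distinct vertices $u,v$ are in conflict in $\pi$ if they are in the same cluster and $(u,v)\notin E$, or in different clusters and $(u,v)\in E$; $c_\pi(v)$ is the number of vertices in conflict with $v$, and $h_2(\pi)=\sum_{v\in V}c_\pi(v)^2$. Flipping $F\subseteq V$ turns $\pi=(V_1,V_2)$ into $\pi\ominus F=(V_1\ominus F,V_2\ominus F)$ ($\ominus$ = symmetric difference). A set $F\subseteq V$ is a $(K,t)$-feasible flipping set for $\pi$ if, with $\pi'=\pi\ominus F$, $\sum_{v\in V}c_{\pi'}(v)\le K$ and $c_{\pi'}(v)\le t$ for every $v\in V$. -}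

module Defs where

open import Data.Nat using (ℕ; zero; suc; _+_; _*_; _∸_; _≤_; _<_)
open import Data.Bool using (Bool; true; false; _xor_; _∧_; not; if_then_else_; _∨_)
open import Data.Fin using (Fin; _≟_)
open import Data.List using (List; map; allFin)
open import Data.Nat.ListAction using (sum)
open import Relation.Nullary.Decidable using (⌊_⌋)
open import Relation.Binary.PropositionalEquality using (_≡_)
open import Data.Sum using (_⊎_)
open import Data.Product using (_×_)

record Graph (n : ℕ) : Set where
  field
    adj    : Fin n → Fin n → Bool
    adj-sym : ∀ u v → adj u v ≡ adj v u
    adj-irr : ∀ v → adj v v ≡ false
open Graph public

ΣV : {n : ℕ} → (Fin n → ℕ) → ℕ
ΣV {n} f = sum (map f (allFin n))

count : {n : ℕ} → (Fin n → Bool) → ℕ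
count p = ΣV (λ v → if p v then 1 else 0)

-- A 2-partition (V₁ , V₂) of V is given by its side function:
-- V₁ = { v | side v ≡ true }, V₂ = { v | side v ≡ false }.
-- (The unordered pair corresponds to the side function up to negation;
--  all notions below are invariant under negation.)
Partition : ℕ → Set
Partition n = Fin n → Bool

∣V₁∣ : {n : ℕ} → Partition n → ℕ
∣V₁∣ π = count π

∣V₂∣ : {n : ℕ} → Partition n → ℕ
∣V₂∣ π = count (λ v → not (π v))

Trivial : {n : ℕ} → Partition n → Set
Trivial π = ∣V₁∣ π ≡ 0 ⊎ ∣V₂∣ π ≡ 0

Extreme : {n : ℕ} → Partition n → Set
Extreme π = ∣V₁∣ π ≡ 1 ⊎ ∣V₂∣ π ≡ 1

sameSide : Bool → Bool → Bool
sameSide a b = not (a xor b)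

inConflict : {n : ℕ} → Graph n → Partition n → Fin n → Fin n → Bool
inConflict G π u v =
  not ⌊ u ≟ v ⌋ ∧ ((sameSide (π u) (π v) ∧ not (adj G u v)) ∨ (not (sameSide (π u) (π v)) ∧ adj G u v))

conf : {n : ℕ} → Graph n → Partition n → Fin n → ℕ
conf G π v = count (λ u → inConflict G π u v)

h₂ : {n : ℕ} → Graph n → Partition n → ℕ
h₂ G π = ΣV (λ v → conf G π v * conf G π v)

VSubset : ℕ → Set
VSubset n = Fin n → Bool

∣_∣ˢ : {n : ℕ} → VSubset n → ℕ
∣ F ∣ˢ = count F

flip : {n : ℕ} → Partition n → VSubset n → Partition n
flip π F v = π v xor F v

closedNbhd : {n : ℕ} → Graph n → Fin n → VSubset n
closedNbhd G s u = adj G u s ∨ ⌊ u ≟ s ⌋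

π₀ : {n : ℕ} → Graph n → Fin n → Partition n
π₀ G s = closedNbhd G s

-- Since all quantities compared are natural numbers (hence ≥ 0):
--   Σ c ≤ √(nk)          ⇔ (Σ c)² ≤ n·k
--   c ≤ √(n(n-1)/2)      ⇔ 2·c² ≤ n·(n-1)
FeasibleFlip : {n : ℕ} → Graph n → (k : ℕ) → Partition n → VSubset n → Set
FeasibleFlip {n} G k π F =
  let π' = flip π F
      S  = ΣV (conf G π')
  in (S * S ≤ n * k) × (∀ v → 2 * (conf G π' v * conf G π' v) ≤ n * (n ∸ 1))

-- |F| ≤ f = √(k/n)  ⇔  n·|F|² ≤ k   (for n > 0; for n = 0 there is no vertex s anyway)
SmallFlip : {n : ℕ} → (k : ℕ) → VSubset n → Set
SmallFlip {n} k F = n * (∣ F ∣ˢ * ∣ F ∣ˢ) ≤ k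

module Submission where

-- Descend from π by single-vertex moves to a partition ρ that no
-- move improves; then h₂(ρ) ≤ h₂(π) ≤ k.  Local optimality bounds every
-- conflict count: 2 c_ρ(v)² ≤ n(n - 1).  This is proved for abstract
-- symmetric 0/1 matrices (the conflict matrices of ρ and of ρ with v moved
-- differ by toggling row and column v), by computing the exact change of
-- Σ deg² and double counting the cross terms.  Let s minimise c_ρ and let F be
-- the set of conflicts of s.  Flipping F in π₀(s) gives ρ up to renaming the
-- sides, so the conflicts after flipping are those of ρ; Cauchy–Schwarz gives
-- (Σ c)² ≤ n h₂(ρ) ≤ nk, and n |F|² = n c_ρ(s)² ≤ Σ c_ρ² ≤ k.

open import Data.Bool using (Bool; true; false; not; _∧_; _∨_; _xor_; if_then_else_)
open import Data.Bool.Properties using (xor-comm; not-distribʳ-xor; xor-identityʳ; xor-same; ∨-zeroʳ)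
open import Data.Fin using (Fin; zero; suc; _≟_)
open import Data.Fin.Properties using (any?)
open import Data.List using (allFin; tabulate)
open import Data.List.Membership.Propositional.Properties using (∈-allFin)
import Data.List.Relation.Unary.All as All
open import Data.List.Properties using (map-tabulate)
open import Data.Nat using (ℕ; zero; suc; _+_; _*_; _∸_; _≤_; _<_; z≤n; s≤s⁻¹; _<?_)
open import Data.Nat.Properties hiding (_≟_)
open import Data.List.Extrema ≤-totalOrder using (argmin; f[argmin]≤f[xs])
open import Data.Nat.Tactic.RingSolver using (solve-∀)
open import Data.Product using (Σ; _×_; _,_)
open import Data.Sum using (inj₁; inj₂)
open import Data.Empty using (⊥-elim)
open import Function using (_∘_; id)
open import Relation.Binary.PropositionalEquality
open import Relation.Nullary using (¬_; Dec; yes; no)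
open import Relation.Nullary.Decidable using (⌊_⌋)
open import Algebra.Properties.Semiring.Sum +-*-semiring
  using (sum; ∑-distrib-+; ∑-comm; sum-cong-≗; *-distribˡ-sum)
import Data.Nat.ListAction as List

open import Defs

iverson : Bool → ℕ
iverson b = if b then 1 else 0

iverson≤1 : ∀ b → iverson b ≤ 1
iverson≤1 true  = ≤-refl
iverson≤1 false = z≤n

-- away v u = [u ≢ v]: weighting a sum by it removes the term at v.
away : {n : ℕ} → Fin n → Fin n → ℕ
away v u = iverson (not ⌊ u ≟ v ⌋)

away-suc : {n : ℕ} (v u : Fin n) → away (suc v) (suc u) ≡ away v u
away-suc v u with u ≟ v
... | yes _ = refl
... | no  _ = refl

away-self : {n : ℕ} (v : Fin n) → away v v ≡ 0
away-self v with v ≟ v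
... | yes _   = refl
... | no  v≢v = ⊥-elim (v≢v refl)

away-≢ : {n : ℕ} {v u : Fin n} → ¬ u ≡ v → away v u ≡ 1
away-≢ {v = v} {u} u≢v with u ≟ v
... | yes u≡v = ⊥-elim (u≢v u≡v)
... | no  _   = refl

ΣV≡sum : {n : ℕ} (f : Fin n → ℕ) → ΣV f ≡ sum f
ΣV≡sum {n} f = trans (cong List.sum (map-tabulate id f)) (tabulate-sum f)
  where
  tabulate-sum : {m : ℕ} (g : Fin m → ℕ) → List.sum (tabulate g) ≡ sum g
  tabulate-sum {zero}  g = refl
  tabulate-sum {suc m} g = cong (g zero +_) (tabulate-sum (g ∘ suc))

sum-const : (n x : ℕ) → sum {n} (λ _ → x) ≡ n * x
sum-const zero    x = refl
sum-const (suc n) x = cong (x +_) (sum-const n x)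

sum-mono : {n : ℕ} {f g : Fin n → ℕ} → (∀ i → f i ≤ g i) → sum f ≤ sum g
sum-mono {zero}  f≤g = z≤n
sum-mono {suc n} f≤g = +-mono-≤ (f≤g zero) (sum-mono (f≤g ∘ suc))

sum-*ˡ : {n : ℕ} (x : ℕ) (f : Fin n → ℕ) → sum (λ i → x * f i) ≡ x * sum f
sum-*ˡ x f = sym (*-distribˡ-sum x f)

sum-*ʳ : {n : ℕ} (x : ℕ) (f : Fin n → ℕ) → sum (λ i → f i * x) ≡ sum f * x
sum-*ʳ x f = trans (sum-cong-≗ (λ i → *-comm (f i) x)) (trans (sum-*ˡ x f) (*-comm x (sum f)))

sum-split : {n : ℕ} (v : Fin n) (f : Fin n → ℕ) → sum f ≡ f v + sum (λ u → away v u * f u)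
sum-split zero    f = cong (f zero +_) (sum-cong-≗ (λ u → sym (*-identityˡ (f (suc u)))))
sum-split (suc v) f = begin
  f zero + sum (f ∘ suc)
    ≡⟨ cong (f zero +_) (sum-split v (f ∘ suc)) ⟩
  f zero + (f (suc v) + rest)
    ≡⟨ x+[y+z]≡y+[1*x+z] (f zero) (f (suc v)) rest ⟩
  f (suc v) + (1 * f zero + rest)
    ≡⟨ cong (λ r → f (suc v) + (1 * f zero + r)) (sum-cong-≗ (λ u → cong (_* f (suc u)) (sym (away-suc v u)))) ⟩
  f (suc v) + sum (λ u → away (suc v) u * f u) ∎
  where
  open ≡-Reasoning
  rest : ℕ
  rest = sum (λ u → away v u * f (suc u))
  x+[y+z]≡y+[1*x+z] : ∀ x y z → x + (y + z) ≡ y + (1 * x + z)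
  x+[y+z]≡y+[1*x+z] = solve-∀

sum-away-cong : {n : ℕ} (v : Fin n) {f g : Fin n → ℕ} → (∀ u → ¬ u ≡ v → f u ≡ g u) →
                sum (λ u → away v u * f u) ≡ sum (λ u → away v u * g u)
sum-away-cong v {f} {g} f≗g = sum-cong-≗ pointwise
  where
  pointwise : ∀ u → away v u * f u ≡ away v u * g u
  pointwise u with u ≟ v
  ... | yes _   = refl
  ... | no  u≢v = cong (_+ 0) (f≗g u u≢v)

sum-split₂ : {n : ℕ} (v : Fin n) (f g : Fin n → ℕ) → g v ≡ 0 →
             sum f + sum g ≡ f v + sum (λ u → away v u * (f u + g u))
sum-split₂ v f g gv≡0 = begin
  sum f + sum g
    ≡⟨ cong₂ _+_ (sum-split v f) (sum-split v g) ⟩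
  (f v + sum (λ u → away v u * f u)) + (g v + sum (λ u → away v u * g u))
    ≡⟨ cong (λ x → (f v + sum (λ u → away v u * f u)) + (x + sum (λ u → away v u * g u))) gv≡0 ⟩
  (f v + sum (λ u → away v u * f u)) + sum (λ u → away v u * g u)
    ≡⟨ +-assoc (f v) _ _ ⟩
  f v + (sum (λ u → away v u * f u) + sum (λ u → away v u * g u))
    ≡⟨ cong (f v +_) (sym (∑-distrib-+ (λ u → away v u * f u) (λ u → away v u * g u))) ⟩
  f v + sum (λ u → away v u * f u + away v u * g u)
    ≡⟨ cong (f v +_) (sum-cong-≗ (λ u → sym (*-distribˡ-+ (away v u) (f u) (g u)))) ⟩
  f v + sum (λ u → away v u * (f u + g u)) ∎
  where open ≡-Reasoning

-- 2ab ≤ a² + b² (two-term AM–GM), first when b = a + t, where the gap is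
-- exactly t², then in general by symmetry.
two-products≤squares-+ : ∀ a t → 2 * (a * (a + t)) ≤ a * a + (a + t) * (a + t)
two-products≤squares-+ a t = subst (2 * (a * (a + t)) ≤_) (square-of-gap a t) (m≤m+n _ (t * t))
  where
  square-of-gap : ∀ a t → 2 * (a * (a + t)) + t * t ≡ a * a + (a + t) * (a + t)
  square-of-gap = solve-∀

two-products≤squares : ∀ a b → 2 * (a * b) ≤ a * a + b * b
two-products≤squares a b with ≤-total a b
... | inj₁ a≤b = subst (λ x → 2 * (a * x) ≤ a * a + x * x) (m+[n∸m]≡n a≤b)
                   (two-products≤squares-+ a (b ∸ a))
... | inj₂ b≤a = subst₂ _≤_ (cong (2 *_) (*-comm b a)) (+-comm (b * b) (a * a))
                   (subst (λ x → 2 * (b * x) ≤ b * b + x * x) (m+[n∸m]≡n b≤a)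
                     (two-products≤squares-+ b (a ∸ b)))

cauchy-schwarz : {n : ℕ} (f : Fin n → ℕ) → sum f * sum f ≤ n * sum (λ i → f i * f i)
cauchy-schwarz {n} f = *-cancelˡ-≤ 2 (begin
  2 * (sum f * sum f)
    ≡⟨ cong (2 *_) square-as-double-sum ⟩
  2 * sum (λ i → sum (λ j → f i * f j))
    ≡⟨ sym (sum-*ˡ 2 (λ i → sum (λ j → f i * f j))) ⟩
  sum (λ i → 2 * sum (λ j → f i * f j))
    ≡⟨ sum-cong-≗ (λ i → sym (sum-*ˡ 2 (λ j → f i * f j))) ⟩
  sum (λ i → sum (λ j → 2 * (f i * f j)))
    ≤⟨ sum-mono (λ i → sum-mono (λ j → two-products≤squares (f i) (f j))) ⟩
  sum (λ i → sum (λ j → f i * f i + f j * f j))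
    ≡⟨ sum-cong-≗ row ⟩
  sum (λ i → n * (f i * f i) + Q)
    ≡⟨ ∑-distrib-+ (λ i → n * (f i * f i)) (λ _ → Q) ⟩
  sum (λ i → n * (f i * f i)) + sum {n} (λ _ → Q)
    ≡⟨ cong₂ _+_ (sum-*ˡ n (λ i → f i * f i)) (sum-const n Q) ⟩
  n * Q + n * Q
    ≡⟨ sym (twice (n * Q)) ⟩
  2 * (n * Q) ∎)
  where
  open ≤-Reasoning
  Q : ℕ
  Q = sum (λ i → f i * f i)
  square-as-double-sum : sum f * sum f ≡ sum (λ i → sum (λ j → f i * f j))
  square-as-double-sum = trans (sym (sum-*ʳ (sum f) f)) (sum-cong-≗ (λ i → sym (sum-*ˡ (f i) f)))
  row : ∀ i → sum (λ j → f i * f i + f j * f j) ≡ n * (f i * f i) + Q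
  row i = trans (∑-distrib-+ (λ _ → f i * f i) (λ j → f j * f j)) (cong (_+ Q) (sum-const n (f i * f i)))
  twice : ∀ x → 2 * x ≡ x + x
  twice x = cong (x +_) (+-identityʳ x)

square-suc : ∀ r → (1 + r) * (1 + r) + 0 * (2 * r + 1) ≡ (0 + r) * (0 + r) + 1 * (2 * r + 1)
square-suc = solve-∀

-- The effect of toggling a 0/1 entry (x, y) = (1, 0) ↔ (0, 1) on a square
-- (y + r)², compensated by the weight 2r + 1 of the entry that was removed.
toggle-square : ∀ x y r → x + y ≡ 1 →
                (y + r) * (y + r) + x * (2 * r + 1) ≡ (x + r) * (x + r) + y * (2 * r + 1)
toggle-square 0 1 r _ = square-suc r
toggle-square 1 0 r _ = sym (square-suc r)
toggle-square 0 0 r ()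
toggle-square 0 (suc (suc y)) r ()
toggle-square (suc zero) (suc y) r ()
toggle-square (suc (suc x)) y r ()

-- The numerical core of the single-flip bound: writing c and d for the
-- conflicts of a vertex before and after flipping it (so c + d + 1 = n),
-- the local-optimality inequality c² + c ≤ 3d² + d forces 2c² ≤ n(n - 1).
flip-arithmetic : ∀ c d → c * c + c ≤ 3 * (d * d) + d → 2 * (c * c) ≤ suc (c + d) * (c + d)
flip-arithmetic c d hyp with ≤-total c d
... | inj₁ c≤d = begin
  2 * (c * c)           ≤⟨ m≤m+n (2 * (c * c)) (2 * (c * c)) ⟩
  2 * (c * c) + 2 * (c * c) ≡⟨ double-square c ⟩
  (2 * c) * (2 * c)     ≤⟨ *-mono-≤ 2c≤c+d 2c≤c+d ⟩
  (c + d) * (c + d)     ≤⟨ m≤n+m ((c + d) * (c + d)) (c + d) ⟩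
  suc (c + d) * (c + d) ∎
  where
  open ≤-Reasoning
  double-square : ∀ c → 2 * (c * c) + 2 * (c * c) ≡ (2 * c) * (2 * c)
  double-square = solve-∀
  2c≤c+d : 2 * c ≤ c + d
  2c≤c+d = subst (_≤ c + d) (cong (c +_) (sym (+-identityʳ c))) (+-monoʳ-≤ c c≤d)
... | inj₂ d≤c = begin
  2 * (c * c)                         ≤⟨ m≤m+n (2 * (c * c)) c ⟩
  2 * (c * c) + c                     ≡⟨ regroup c ⟩
  c * c + (c * c + c)                 ≤⟨ +-monoʳ-≤ (c * c) (≤-trans hyp 3d²+d≤) ⟩
  c * c + (d * d + 2 * (c * d) + d)   ≤⟨ m≤m+n _ c ⟩
  c * c + (d * d + 2 * (c * d) + d) + c ≡⟨ expand c d ⟩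
  suc (c + d) * (c + d)               ∎
  where
  open ≤-Reasoning
  regroup : ∀ c → 2 * (c * c) + c ≡ c * c + (c * c + c)
  regroup = solve-∀
  expand : ∀ c d → c * c + (d * d + 2 * (c * d) + d) + c ≡ suc (c + d) * (c + d)
  expand = solve-∀
  3d²+d≤ : 3 * (d * d) + d ≤ d * d + 2 * (c * d) + d
  3d²+d≤ = begin
    3 * (d * d) + d             ≡⟨ cong (_+ d) (split-three (d * d)) ⟩
    d * d + 2 * (d * d) + d     ≤⟨ +-monoˡ-≤ d (+-monoʳ-≤ (d * d) (*-monoʳ-≤ 2 (*-monoˡ-≤ d d≤c))) ⟩
    d * d + 2 * (c * d) + d     ∎
    where
    split-three : ∀ x → 3 * x ≡ x + 2 * x
    split-three = solve-∀

Matrix : ℕ → Set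
Matrix n = Fin n → Fin n → ℕ

-- Column sums ("degrees") and the sum of their squares, which is h₂ for
-- the conflict matrix of a partition.
deg : {n : ℕ} → Matrix n → Fin n → ℕ
deg X w = sum (λ u → X u w)

sumDeg² : {n : ℕ} → Matrix n → ℕ
sumDeg² X = sum (λ w → deg X w * deg X w)

-- This is how the conflict matrix changes when the vertex v switches side.
record SingleFlip {n : ℕ} (X Y : Matrix n) (v : Fin n) : Set where
  field
    X-sym     : ∀ u w → X u w ≡ X w u
    Y-sym     : ∀ u w → Y u w ≡ Y w u
    X-01      : ∀ u w → X u w ≤ 1
    toggled   : ∀ u → X u v + Y u v ≡ away v u
    unchanged : ∀ u w → ¬ u ≡ v → ¬ w ≡ v → Y u w ≡ X u w

-- If flipping v does not decrease Σ deg², then deg(v)² is at most n(n-1)/2.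
-- Write c = deg X v, d = deg Y v (so c + d = n - 1), x_w = X w v, y_w = Y w v
-- and r_w = rest w for the degree of w ≠ v not counting v.  The change of
-- Σ deg² is d² - c² + Σ_w (y_w - x_w)(2r_w + 1), and the cross terms
-- Σ_w y_w r_w exceed Σ_w x_w r_w by at most d².
module SingleFlipBound {n : ℕ} {X Y : Matrix n} {v : Fin n} (flipped : SingleFlip X Y v) where

  open SingleFlip flipped

  c d : ℕ
  c = deg X v
  d = deg Y v

  X-vv : X v v ≡ 0
  X-vv = m+n≡0⇒m≡0 (X v v) (trans (toggled v) (away-self v))

  Y-vv : Y v v ≡ 0
  Y-vv = m+n≡0⇒n≡0 (X v v) (trans (toggled v) (away-self v))

  -- every vertex other than v conflicts with v either before or after the flip
  degrees-complementary : suc (c + d) ≡ n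
  degrees-complementary = begin
    suc (c + d)                          ≡⟨ cong suc (sym (∑-distrib-+ (λ u → X u v) (λ u → Y u v))) ⟩
    suc (sum (λ u → X u v + Y u v))      ≡⟨ cong suc (sum-cong-≗ (λ u → trans (toggled u) (sym (*-identityʳ (away v u))))) ⟩
    suc (sum (λ u → away v u * 1))       ≡⟨ sym (sum-split v (λ _ → 1)) ⟩
    sum {n} (λ _ → 1)                    ≡⟨ sum-const n 1 ⟩
    n * 1                                ≡⟨ *-identityʳ n ⟩
    n                                    ∎
    where open ≡-Reasoning

  -- the degree of w not counting v; the flip does not change it
  rest : Fin n → ℕ
  rest w = sum (λ u → away v u * X u w)

  deg-X : ∀ w → deg X w ≡ X w v + rest w
  deg-X w = trans (sum-split v (λ u → X u w)) (cong (_+ rest w) (X-sym v w))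

  deg-Y : ∀ w → ¬ w ≡ v → deg Y w ≡ Y w v + rest w
  deg-Y w w≢v = trans (sum-split v (λ u → Y u w))
    (cong₂ _+_ (Y-sym v w) (sum-away-cong v (λ u u≢v → unchanged u w u≢v w≢v)))

  S : Matrix n → ℕ
  S Z = sum (λ w → Z w v * (2 * rest w + 1))

  off-v : Matrix n → Matrix n → ℕ
  off-v Z W = sum (λ w → away v w * (deg Z w * deg Z w + W w v * (2 * rest w + 1)))

  split-at-v : ∀ Z W → W v v ≡ 0 → sumDeg² Z + S W ≡ deg Z v * deg Z v + off-v Z W
  split-at-v Z W Wvv≡0 = sum-split₂ v (λ w → deg Z w * deg Z w) (λ w → W w v * (2 * rest w + 1))
                           (cong (_* (2 * rest v + 1)) Wvv≡0)

  off-v-exchange : off-v Y X ≡ off-v X Y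
  off-v-exchange = sum-away-cong v λ w w≢v → begin
    deg Y w * deg Y w + X w v * (2 * rest w + 1)
      ≡⟨ cong (λ t → t * t + X w v * (2 * rest w + 1)) (deg-Y w w≢v) ⟩
    (Y w v + rest w) * (Y w v + rest w) + X w v * (2 * rest w + 1)
      ≡⟨ toggle-square (X w v) (Y w v) (rest w) (trans (toggled w) (away-≢ w≢v)) ⟩
    (X w v + rest w) * (X w v + rest w) + Y w v * (2 * rest w + 1)
      ≡⟨ cong (λ t → t * t + Y w v * (2 * rest w + 1)) (sym (deg-X w)) ⟩
    deg X w * deg X w + Y w v * (2 * rest w + 1) ∎
    where open ≡-Reasoning

  exchange : sumDeg² Y + S X + c * c ≡ sumDeg² X + S Y + d * d
  exchange = begin
    sumDeg² Y + S X + c * c     ≡⟨ cong (_+ c * c) (split-at-v Y X X-vv) ⟩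
    d * d + off-v Y X + c * c   ≡⟨ cong (λ t → d * d + t + c * c) off-v-exchange ⟩
    d * d + off-v X Y + c * c   ≡⟨ swap-ends (d * d) (off-v X Y) (c * c) ⟩
    c * c + off-v X Y + d * d   ≡⟨ cong (_+ d * d) (sym (split-at-v X Y Y-vv)) ⟩
    sumDeg² X + S Y + d * d     ∎
    where
    open ≡-Reasoning
    swap-ends : ∀ a b e → a + b + e ≡ e + b + a
    swap-ends = solve-∀

  A : Matrix n → ℕ
  A Z = sum (λ w → Z w v * rest w)

  S≡2A+deg : ∀ Z → S Z ≡ 2 * A Z + deg Z v
  S≡2A+deg Z = begin
    sum (λ w → Z w v * (2 * rest w + 1))
      ≡⟨ sum-cong-≗ (λ w → distribute (Z w v) (rest w)) ⟩
    sum (λ w → 2 * (Z w v * rest w) + Z w v)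
      ≡⟨ ∑-distrib-+ (λ w → 2 * (Z w v * rest w)) (λ w → Z w v) ⟩
    sum (λ w → 2 * (Z w v * rest w)) + deg Z v
      ≡⟨ cong (_+ deg Z v) (sum-*ˡ 2 (λ w → Z w v * rest w)) ⟩
    2 * A Z + deg Z v ∎
    where
    open ≡-Reasoning
    distribute : ∀ z r → z * (2 * r + 1) ≡ 2 * (z * r) + z
    distribute = solve-∀

  common : Fin n → ℕ
  common w = sum (λ u → X u v * X u w)

  -- split the conflicts u ≠ v of w by whether u conflicts with v before or after
  rest≤common+d : ∀ w → rest w ≤ common w + d
  rest≤common+d w = begin
    sum (λ u → away v u * X u w)
      ≡⟨ sum-cong-≗ (λ u → cong (_* X u w) (sym (toggled u))) ⟩
    sum (λ u → (X u v + Y u v) * X u w)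
      ≡⟨ sum-cong-≗ (λ u → *-distribʳ-+ (X u w) (X u v) (Y u v)) ⟩
    sum (λ u → X u v * X u w + Y u v * X u w)
      ≡⟨ ∑-distrib-+ (λ u → X u v * X u w) (λ u → Y u v * X u w) ⟩
    common w + sum (λ u → Y u v * X u w)
      ≤⟨ +-monoʳ-≤ (common w) (sum-mono (λ u → ≤-trans (*-monoʳ-≤ (Y u v) (X-01 u w)) (≤-reflexive (*-identityʳ (Y u v))))) ⟩
    common w + d ∎
    where open ≤-Reasoning

  Y-wv≤away : ∀ w → Y w v ≤ away v w
  Y-wv≤away w = subst (Y w v ≤_) (toggled w) (m≤n+m (Y w v) (X w v))

  -- double counting: paths w – u – v with w new and u old conflicts of v
  A-bound : A Y ≤ A X + d * d
  A-bound = begin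
    sum (λ w → Y w v * rest w)
      ≤⟨ sum-mono (λ w → *-monoʳ-≤ (Y w v) (rest≤common+d w)) ⟩
    sum (λ w → Y w v * (common w + d))
      ≡⟨ sum-cong-≗ (λ w → *-distribˡ-+ (Y w v) (common w) d) ⟩
    sum (λ w → Y w v * common w + Y w v * d)
      ≡⟨ ∑-distrib-+ (λ w → Y w v * common w) (λ w → Y w v * d) ⟩
    sum (λ w → Y w v * common w) + sum (λ w → Y w v * d)
      ≡⟨ cong₂ _+_ (sum-cong-≗ (λ w → sym (sum-*ˡ (Y w v) (λ u → X u v * X u w)))) (sum-*ʳ d (λ w → Y w v)) ⟩
    sum (λ w → sum (λ u → Y w v * (X u v * X u w))) + d * d
      ≡⟨ cong (_+ d * d) (∑-comm (λ w u → Y w v * (X u v * X u w))) ⟩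
    sum (λ u → sum (λ w → Y w v * (X u v * X u w))) + d * d
      ≤⟨ +-monoˡ-≤ (d * d) (sum-mono (λ u → sum-mono (λ w → path-bound u w))) ⟩
    sum (λ u → sum (λ w → X u v * (away v w * X w u))) + d * d
      ≡⟨ cong (_+ d * d) (sum-cong-≗ (λ u → sum-*ˡ (X u v) (λ w → away v w * X w u))) ⟩
    A X + d * d ∎
    where
    open ≤-Reasoning
    reorder : ∀ y x z → y * (x * z) ≡ x * (y * z)
    reorder = solve-∀
    path-bound : ∀ u w → Y w v * (X u v * X u w) ≤ X u v * (away v w * X w u)
    path-bound u w = ≤-trans (≤-reflexive (reorder (Y w v) (X u v) (X u w)))
      (*-monoʳ-≤ (X u v) (*-mono-≤ (Y-wv≤away w) (≤-reflexive (X-sym u w))))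

  no-improvement : sumDeg² X ≤ sumDeg² Y → c * c + c ≤ 3 * (d * d) + d
  no-improvement X≤Y = +-cancelˡ-≤ (2 * A X) _ _ (begin
    2 * A X + (c * c + c)           ≡⟨ shuffle₁ (A X) c ⟩
    c * c + (2 * A X + c)           ≡⟨ cong (c * c +_) (sym (S≡2A+deg X)) ⟩
    c * c + S X                     ≤⟨ squares-vs-S ⟩
    d * d + S Y                     ≡⟨ cong (d * d +_) (S≡2A+deg Y) ⟩
    d * d + (2 * A Y + d)           ≤⟨ +-monoʳ-≤ (d * d) (+-monoˡ-≤ d (*-monoʳ-≤ 2 A-bound)) ⟩
    d * d + (2 * (A X + d * d) + d) ≡⟨ shuffle₂ (A X) d ⟩
    2 * A X + (3 * (d * d) + d)     ∎)
    where
    open ≤-Reasoning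
    shuffle₁ : ∀ a c → 2 * a + (c * c + c) ≡ c * c + (2 * a + c)
    shuffle₁ = solve-∀
    shuffle₂ : ∀ a d → d * d + (2 * (a + d * d) + d) ≡ 2 * a + (3 * (d * d) + d)
    shuffle₂ = solve-∀
    shuffle₃ : ∀ h s e → h + (e + s) ≡ h + s + e
    shuffle₃ = solve-∀
    squares-vs-S : c * c + S X ≤ d * d + S Y
    squares-vs-S = +-cancelˡ-≤ (sumDeg² X) _ _ (begin
      sumDeg² X + (c * c + S X) ≡⟨ shuffle₃ (sumDeg² X) (S X) (c * c) ⟩
      sumDeg² X + S X + c * c   ≤⟨ +-monoˡ-≤ (c * c) (+-monoˡ-≤ (S X) X≤Y) ⟩
      sumDeg² Y + S X + c * c   ≡⟨ exchange ⟩
      sumDeg² X + S Y + d * d   ≡⟨ sym (shuffle₃ (sumDeg² X) (S Y) (d * d)) ⟩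
      sumDeg² X + (d * d + S Y) ∎)

  single-flip-bound : sumDeg² X ≤ sumDeg² Y → 2 * (c * c) ≤ n * (n ∸ 1)
  single-flip-bound X≤Y = subst (λ m → 2 * (c * c) ≤ m * (m ∸ 1)) degrees-complementary
                            (flip-arithmetic c d (no-improvement X≤Y))

-- Every p lies above a local minimum of h for finitely many moves: descend
-- along improving moves while one exists; h bounds the number of steps.
local-minimum : {P : Set} {n : ℕ} (h : P → ℕ) (move : P → Fin n → P) (p : P) →
                Σ P (λ ρ → h ρ ≤ h p × (∀ v → h ρ ≤ h (move ρ v)))
local-minimum {P} h move p = descend (suc (h p)) p ≤-refl
  where
  descend : ∀ fuel q → h q < fuel → Σ P (λ ρ → h ρ ≤ h q × (∀ v → h ρ ≤ h (move ρ v)))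
  descend zero       q ()
  descend (suc fuel) q hq<fuel with any? (λ v → h (move q v) <? h q)
  ... | yes (v , better) with descend fuel (move q v) (<-≤-trans better (s≤s⁻¹ hq<fuel))
  ...   | ρ , ρ≤ , stuck = ρ , ≤-trans ρ≤ (<⇒≤ better) , stuck
  descend (suc fuel) q _ | no none = q , ≤-refl , λ v → ≮⇒≥ (λ better → none (v , better))

minimum-vertex : {n : ℕ} (f : Fin (suc n) → ℕ) → Σ (Fin (suc n)) (λ s → ∀ v → f s ≤ f v)
minimum-vertex {n} f = argmin f zero (allFin (suc n)) ,
  λ v → All.lookup (f[argmin]≤f[xs] {f = f} zero (allFin (suc n))) (∈-allFin v)

clash : Bool → Bool → Bool
clash same a = (same ∧ not a) ∨ (not same ∧ a)

clash-not : ∀ s a → clash (not s) a ≡ not (clash s a)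
clash-not false false = refl
clash-not false true  = refl
clash-not true  false = refl
clash-not true  true  = refl

sameSide-comm : ∀ p q → sameSide p q ≡ sameSide q p
sameSide-comm p q = cong not (xor-comm p q)

sameSide-not : ∀ p q → sameSide p (not q) ≡ not (sameSide p q)
sameSide-not p q = cong not (sym (not-distribʳ-xor p q))

-- sameSide b renames the two sides when b = false and keeps them when
-- b = true; in either case it preserves sameSide
sameSide-relabel : ∀ b p q → sameSide (sameSide b p) (sameSide b q) ≡ sameSide p q
sameSide-relabel false false false = refl
sameSide-relabel false false true  = refl
sameSide-relabel false true  false = refl
sameSide-relabel false true  true  = refl
sameSide-relabel true  false false = refl
sameSide-relabel true  false true  = refl
sameSide-relabel true  true  false = refl
sameSide-relabel true  true  true  = refl

iverson-not : ∀ b → iverson b + iverson (not b) ≡ 1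
iverson-not false = refl
iverson-not true  = refl

⌊≟⌋-sym : {n : ℕ} (u w : Fin n) → ⌊ u ≟ w ⌋ ≡ ⌊ w ≟ u ⌋
⌊≟⌋-sym u w with u ≟ w | w ≟ u
... | yes _   | yes _   = refl
... | no  _   | no  _   = refl
... | yes u≡w | no  w≢u = ⊥-elim (w≢u (sym u≡w))
... | no  u≢w | yes w≡u = ⊥-elim (u≢w (sym w≡u))

move : {n : ℕ} → Partition n → Fin n → Partition n
move π v = flip π (λ u → ⌊ u ≟ v ⌋)

move-self : {n : ℕ} (π : Partition n) (v : Fin n) → move π v v ≡ not (π v)
move-self π v with v ≟ v
... | yes _   = trans (sym (not-distribʳ-xor (π v) false)) (cong not (xor-identityʳ (π v)))
... | no  v≢v = ⊥-elim (v≢v refl)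

move-other : {n : ℕ} (π : Partition n) {v u : Fin n} → ¬ u ≡ v → move π v u ≡ π u
move-other π {v} {u} u≢v with u ≟ v
... | yes u≡v = ⊥-elim (u≢v u≡v)
... | no  _   = xor-identityʳ (π u)

conflicts : {n : ℕ} → Graph n → Partition n → Matrix n
conflicts G π u w = iverson (inConflict G π u w)

module _ {n : ℕ} (G : Graph n) where

  conf≡deg : ∀ π w → conf G π w ≡ deg (conflicts G π) w
  conf≡deg π w = ΣV≡sum (λ u → conflicts G π u w)

  h₂≡sumDeg² : ∀ π → h₂ G π ≡ sumDeg² (conflicts G π)
  h₂≡sumDeg² π = trans (ΣV≡sum (λ w → conf G π w * conf G π w))
                   (sum-cong-≗ (λ w → cong₂ _*_ (conf≡deg π w) (conf≡deg π w)))

  conflicts-local : ∀ {π π' : Partition n} u w → π u ≡ π' u → π w ≡ π' w →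
                    conflicts G π u w ≡ conflicts G π' u w
  conflicts-local u w = cong₂ (λ p q → iverson (not ⌊ u ≟ w ⌋ ∧ clash (sameSide p q) (adj G u w)))

  conflicts-self : ∀ π u → conflicts G π u u ≡ 0
  conflicts-self π u with u ≟ u
  ... | yes _   = refl
  ... | no  u≢u = ⊥-elim (u≢u refl)

  conflicts-≢ : ∀ π {u w} → ¬ u ≡ w → conflicts G π u w ≡ iverson (clash (sameSide (π u) (π w)) (adj G u w))
  conflicts-≢ π {u} {w} u≢w with u ≟ w
  ... | yes u≡w = ⊥-elim (u≢w u≡w)
  ... | no  _   = refl

  conflicts-sym : ∀ π u w → conflicts G π u w ≡ conflicts G π w u
  conflicts-sym π u w = trans
    (cong₂ (λ e s → iverson (not e ∧ clash s (adj G u w))) (⌊≟⌋-sym u w) (sameSide-comm (π u) (π w)))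
    (cong (λ a → iverson (not ⌊ w ≟ u ⌋ ∧ clash (sameSide (π w) (π u)) a)) (adj-sym G u w))

  move-single-flip : ∀ π v → SingleFlip (conflicts G π) (conflicts G (move π v)) v
  move-single-flip π v = record
    { X-sym     = conflicts-sym π
    ; Y-sym     = conflicts-sym (move π v)
    ; X-01      = λ u w → iverson≤1 (inConflict G π u w)
    ; toggled   = λ u → toggled u (u ≟ v)
    ; unchanged = λ u w u≢v w≢v → conflicts-local u w (move-other π u≢v) (move-other π w≢v)
    }
    where
    toggled : ∀ u → Dec (u ≡ v) → conflicts G π u v + conflicts G (move π v) u v ≡ away v u
    toggled u (yes refl) =
      trans (cong₂ _+_ (conflicts-self π u) (conflicts-self (move π u) u)) (sym (away-self u))
    toggled u (no u≢v) = begin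
      conflicts G π u v + conflicts G (move π v) u v
        ≡⟨ cong₂ _+_ (conflicts-≢ π u≢v) (conflicts-≢ (move π v) u≢v) ⟩
      iverson (clash s a) + iverson (clash (sameSide (move π v u) (move π v v)) a)
        ≡⟨ cong₂ (λ p q → iverson (clash s a) + iverson (clash (sameSide p q) a)) (move-other π u≢v) (move-self π v) ⟩
      iverson (clash s a) + iverson (clash (sameSide (π u) (not (π v))) a)
        ≡⟨ cong (λ t → iverson (clash s a) + iverson (clash t a)) (sameSide-not (π u) (π v)) ⟩
      iverson (clash s a) + iverson (clash (not s) a)
        ≡⟨ cong (λ t → iverson (clash s a) + iverson t) (clash-not s a) ⟩
      iverson (clash s a) + iverson (not (clash s a))
        ≡⟨ iverson-not (clash s a) ⟩
      1
        ≡⟨ sym (away-≢ u≢v) ⟩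
      away v u ∎
      where
      open ≡-Reasoning
      s a : Bool
      s = sameSide (π u) (π v)
      a = adj G u v

  locally-optimal-bound : ∀ ρ → (∀ v → h₂ G ρ ≤ h₂ G (move ρ v)) →
                          ∀ v → 2 * (conf G ρ v * conf G ρ v) ≤ n * (n ∸ 1)
  locally-optimal-bound ρ stuck v = subst (λ c → 2 * (c * c) ≤ n * (n ∸ 1)) (sym (conf≡deg ρ v))
    (SingleFlipBound.single-flip-bound (move-single-flip ρ v)
      (subst₂ _≤_ (h₂≡sumDeg² ρ) (h₂≡sumDeg² (move ρ v)) (stuck v)))

  conflictSet : Partition n → Fin n → VSubset n
  conflictSet ρ s u = inConflict G ρ u s

  -- flipping the conflict set of s in π₀(s) = (N[s], V ∖ N[s]) yields ρ,
  -- with the sides named so that s lies in the first one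
  π₀-flip-conflictSet : ∀ ρ s u → flip (π₀ G s) (conflictSet ρ s) u ≡ sameSide (ρ s) (ρ u)
  π₀-flip-conflictSet ρ s u with u ≟ s
  ... | yes refl = trans (cong (_xor false) (∨-zeroʳ (adj G u u))) (cong not (sym (xor-same (ρ u))))
  ... | no  _    = neighbour-xor-clash (adj G u s) (ρ u) (ρ s)
    where
    neighbour-xor-clash : ∀ a p q → (a ∨ false) xor clash (sameSide p q) a ≡ sameSide q p
    neighbour-xor-clash false false false = refl
    neighbour-xor-clash false false true  = refl
    neighbour-xor-clash false true  false = refl
    neighbour-xor-clash false true  true  = refl
    neighbour-xor-clash true  false false = refl
    neighbour-xor-clash true  false true  = refl
    neighbour-xor-clash true  true  false = refl
    neighbour-xor-clash true  true  true  = refl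

  conflicts-relabel : ∀ b ρ u w → conflicts G (λ x → sameSide b (ρ x)) u w ≡ conflicts G ρ u w
  conflicts-relabel b ρ u w =
    cong (λ t → iverson (not ⌊ u ≟ w ⌋ ∧ clash t (adj G u w))) (sameSide-relabel b (ρ u) (ρ w))

  conf-π₀-flip : ∀ ρ s w → conf G (flip (π₀ G s) (conflictSet ρ s)) w ≡ conf G ρ w
  conf-π₀-flip ρ s w = begin
    conf G (flip (π₀ G s) (conflictSet ρ s)) w
      ≡⟨ conf≡deg (flip (π₀ G s) (conflictSet ρ s)) w ⟩
    sum (λ u → conflicts G (flip (π₀ G s) (conflictSet ρ s)) u w)
      ≡⟨ sum-cong-≗ (λ u → conflicts-local u w (π₀-flip-conflictSet ρ s u) (π₀-flip-conflictSet ρ s w)) ⟩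
    sum (λ u → conflicts G (λ x → sameSide (ρ s) (ρ x)) u w)
      ≡⟨ sum-cong-≗ (λ u → conflicts-relabel (ρ s) ρ u w) ⟩
    sum (λ u → conflicts G ρ u w)
      ≡⟨ sym (conf≡deg ρ w) ⟩
    conf G ρ w ∎
    where open ≡-Reasoning

  -- The flipping set F = conflicts of s works for π₀(s) whenever ρ is locally
  -- optimal, s has the fewest conflicts in ρ and h₂(ρ) ≤ k: after flipping,
  -- the conflicts are those of ρ, so (Σ c)² ≤ n h₂(ρ) ≤ nk by Cauchy–Schwarz,
  -- and n |F|² = n c(s)² ≤ Σ c² ≤ k because c(s) is minimal.
  conflictSet-feasible : ∀ k ρ s → (∀ v → h₂ G ρ ≤ h₂ G (move ρ v)) → (∀ v → conf G ρ s ≤ conf G ρ v) →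
                         h₂ G ρ ≤ k → FeasibleFlip G k (π₀ G s) (conflictSet ρ s) × SmallFlip k (conflictSet ρ s)
  conflictSet-feasible k ρ s stuck fewest h₂ρ≤k = (total-bound , vertex-bound) , small
    where
    c : Fin n → ℕ
    c = conf G ρ

    π' : Partition n
    π' = flip (π₀ G s) (conflictSet ρ s)

    Σc²≤k : sum (λ w → c w * c w) ≤ k
    Σc²≤k = subst (_≤ k) (ΣV≡sum (λ w → c w * c w)) h₂ρ≤k

    total-bound : ΣV (conf G π') * ΣV (conf G π') ≤ n * k
    total-bound = begin
      ΣV (conf G π') * ΣV (conf G π') ≡⟨ cong (λ t → t * t) (trans (ΣV≡sum (conf G π')) (sum-cong-≗ (conf-π₀-flip ρ s))) ⟩
      sum c * sum c                   ≤⟨ cauchy-schwarz c ⟩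
      n * sum (λ w → c w * c w)       ≤⟨ *-monoʳ-≤ n Σc²≤k ⟩
      n * k                           ∎
      where open ≤-Reasoning

    vertex-bound : ∀ v → 2 * (conf G π' v * conf G π' v) ≤ n * (n ∸ 1)
    vertex-bound v = subst (λ t → 2 * (t * t) ≤ n * (n ∸ 1)) (sym (conf-π₀-flip ρ s v))
                       (locally-optimal-bound ρ stuck v)

    small : n * (c s * c s) ≤ k
    small = begin
      n * (c s * c s)               ≡⟨ sym (sum-const n (c s * c s)) ⟩
      sum {n} (λ _ → c s * c s)     ≤⟨ sum-mono (λ w → *-mono-≤ (fewest w) (fewest w)) ⟩
      sum (λ w → c w * c w)         ≤⟨ Σc²≤k ⟩
      k                             ∎
      where open ≤-Reasoning

flipping-set-exists : (m : ℕ) (G : Graph (suc m)) (k : ℕ) (π : Partition (suc m)) → h₂ G π ≤ k →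
  Σ (Fin (suc m)) (λ s → Σ (VSubset (suc m)) (λ F → FeasibleFlip G k (π₀ G s) F × SmallFlip k F))
flipping-set-exists m G k π h₂π≤k =
  let ρ , ρ≤π , stuck = local-minimum (h₂ G) move π
      s , fewest      = minimum-vertex (conf G ρ)
  in s , conflictSet G ρ s , conflictSet-feasible G k ρ s stuck fewest (≤-trans ρ≤π h₂π≤k)

-- Corollary 5.
corollary5 : (n : ℕ) (G : Graph n) (k : ℕ)
    → (∀ (π : Partition n) → Extreme π → k < h₂ G π)
    → Σ (Partition n) (λ π → ¬ Trivial π × ¬ Extreme π × h₂ G π ≤ k)
    → Σ (Fin n) (λ s → Σ (VSubset n) (λ F → FeasibleFlip G k (π₀ G s) F × SmallFlip k F))
corollary5 zero    G k _ (π , nontrivial , _ , _) = ⊥-elim (nontrivial (inj₁ refl))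
corollary5 (suc m) G k _ (π , _ , _ , h₂π≤k)      = flipping-set-exists m G k π h₂π≤k
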